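{- Let $w$ be a Baxter permutation of length $n$ fixed under $90^{\circ}$ rotation. Then $w$ has the same number, say $k$, of left-to-right maxima and right-to-left maxima. Let the left-to-right maxima of $w$ be at positions $x_1<x_2<\cdots<x_k$ and the right-to-left maxima at positions $y_k<y_{k-1}<\cdots<y_1$, and fix $1\le i\le k$. Let $w'$ be a Baxter permutation of length $n+4$ fixed under $90^{\circ}$ rotation such that deleting from $w'$ its largest entry $n+4$, its smallest entry $1$, its first entry and its last entry (and standardizing the remaining entries to $[n]$) yields $w$, and such that in $w'$ the entry $n+4$ lies immediately to the right of the entry originating from $w_{y_i}$ (or immediately to the left of the entry originating from $w_{x_i}$). Then $w'$ has exactly $i+1$ left-to-right maxima and exactly $i+1$ right-to-left maxima.
   Context: A permutation $w=w_1\ldots w_n$ is a Baxter permutation if there are no indices $i<j<j+1<k$ with $w_j<w_k<w_i<w_{j+1}$ (pattern 3-14-2) and no indices $i<j<j+1<k$ with $w_{j+1}<w_i<w_k<w_j$ (pattern 2-41-3). A permutation $w$ of length $n$ is fixed under $90^{\circ}$ rotation (of its permutation matrix) if for all $i$, $w_i=j$ implies $w_j=n+1-i$ (equivalently $w_{w_i}=n+1-i$ for all $i$). An entry $w_i$ is a left-to-right maximum if $w_i>w_m$ for all $m<i$, and a right-to-left maximum if $w_i>w_m$ for all $m>i$. -}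

module Defs where

open import Data.Nat using (ℕ; zero; suc; _+_; _∸_; _≤_; _<_; _<?_; _≤?_; _≟_)
open import Data.List using (List; []; _∷_; map; upTo; filter; length; reverse)
open import Data.List.Relation.Unary.All using (All; all?)
open import Data.Product using (_×_; ∃; ∃-syntax)
open import Relation.Nullary using (¬_; Dec; yes; no; _×-dec_)
open import Relation.Nullary.Decidable using (¬?)
open import Relation.Binary.PropositionalEquality using (_≡_; _≢_)

-- Convention: a permutation of length n is a function w : ℕ → ℕ, read on
-- positions 1..n (1-indexed, as in the paper); values outside 1..n ignored.

range : ℕ → List ℕ
range n = map suc (upTo n)

rangeFromTo : ℕ → ℕ → List ℕ
rangeFromTo a b = map (λ t → a + t) (upTo (suc b ∸ a))

-- 0-indexed list access with default 0 (only used with in-range indices)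
nth : List ℕ → ℕ → ℕ
nth []       _       = 0
nth (x ∷ xs) zero    = x
nth (x ∷ xs) (suc i) = nth xs i

IsPerm : ℕ → (ℕ → ℕ) → Set
IsPerm n w =
  (∀ i → 1 ≤ i → i ≤ n → (1 ≤ w i × w i ≤ n)) ×
  (∀ i j → 1 ≤ i → i ≤ n → 1 ≤ j → j ≤ n → w i ≡ w j → i ≡ j)

-- Baxter: avoids 3-14-2 and 2-41-3 (with j, j+1 adjacent)
IsBaxter : ℕ → (ℕ → ℕ) → Set
IsBaxter n w =
  (¬ (∃[ i ] ∃[ j ] ∃[ k ] (1 ≤ i × i < j × suc j < k × k ≤ n ×
        w j < w k × w k < w i × w i < w (suc j)))) ×
  (¬ (∃[ i ] ∃[ j ] ∃[ k ] (1 ≤ i × i < j × suc j < k × k ≤ n ×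
        w (suc j) < w i × w i < w k × w k < w j)))

RotFixed : ℕ → (ℕ → ℕ) → Set
RotFixed n w = ∀ i → 1 ≤ i → i ≤ n → w (w i) ≡ suc n ∸ i

LRMax : (ℕ → ℕ) → ℕ → Set
LRMax w i = All (λ m → w m < w i) (range (i ∸ 1))

lrMax? : (w : ℕ → ℕ) → (i : ℕ) → Dec (LRMax w i)
lrMax? w i = all? (λ m → w m <? w i) (range (i ∸ 1))

RLMax : ℕ → (ℕ → ℕ) → ℕ → Set
RLMax n w i = All (λ m → w m < w i) (rangeFromTo (suc i) n)

rlMax? : (n : ℕ) → (w : ℕ → ℕ) → (i : ℕ) → Dec (RLMax n w i)
rlMax? n w i = all? (λ m → w m <? w i) (rangeFromTo (suc i) n)

lrMaxPositions : ℕ → (ℕ → ℕ) → List ℕ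
lrMaxPositions n w = filter (lrMax? w) (range n)

-- positions y_1 > y_2 > ... > y_k of the right-to-left maxima
-- (listed as y_1, y_2, ..., i.e. in decreasing order of position)
rlMaxPositions : ℕ → (ℕ → ℕ) → List ℕ
rlMaxPositions n w = reverse (filter (rlMax? n w) (range n))

keptPositions : ℕ → (ℕ → ℕ) → List ℕ
keptPositions N w' =
  filter (λ p → ¬? (w' p ≟ 1) ×-dec ¬? (w' p ≟ N)) (rangeFromTo 2 (N ∸ 1))

-- position in w' (of length n+4) of the entry originating from w_j
origin : ℕ → (ℕ → ℕ) → ℕ → ℕ
origin n w' j = nth (keptPositions (n + 4) w') (j ∸ 1)

standardize : ℕ → (ℕ → ℕ) → ℕ → ℕ
standardize n w' v = length (filter (λ q → w' q ≤? v) (keptPositions (n + 4) w'))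

DeletesTo : ℕ → (ℕ → ℕ) → (ℕ → ℕ) → Set
DeletesTo n w' w =
  length (keptPositions (n + 4) w') ≡ n ×
  (∀ j → 1 ≤ j → j ≤ n → standardize n w' (w' (origin n w' j)) ≡ w j)

-- Rotating the permutation matrix by 90° sends the point (p, w p) to (w p, n + 1 - p).
-- Hence for a rotation-invariant w, p ↦ w p maps the left-to-right maxima increasingly
-- onto the right-to-left maxima, and both have the same number.
--
-- For w′ of length N = n + 4 put a = w′ 1; invariance gives w′ a = N, so the maximum sits
-- at position a. If it sits just left of the entry coming from x_i, the left-to-right
-- maxima of w′ are position 1, the entries coming from x_1, ..., x_(i-1), and position a.
-- The one delicate point is w′ 2 > a: otherwise position w′ 2 < a, which holds the value
-- w′ (w′ 2) = N - 1, would be a surviving position before x_i, forcing the entry coming from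
-- x_i to be N. Right-to-left maxima are then counted by the first part. The case where N
-- sits just right of the entry coming from y_i is the same argument after reversing
-- positions, which preserves rotation invariance and swaps the two kinds of maxima.
module Submission where

open import Defs
open import Data.Nat using (ℕ; zero; suc; _+_; _∸_; _⊓_; _≤_; _<_; _≟_; _≤?_; _<?_; s≤s; z<s)
open import Data.Nat.Properties
open import Data.List using (List; []; _∷_; map; filter; length; reverse; take; _++_; [_])
open import Data.List.Properties using (filter-accept; filter-reject; length-map; length-reverse; length-take; length-++; unfold-reverse)
open import Data.List.Relation.Unary.All as All using (All; []; _∷_)
import Data.List.Relation.Unary.All.Properties as All
open import Data.List.Relation.Unary.AllPairs as AllPairs using (AllPairs; []; _∷_)
import Data.List.Relation.Unary.AllPairs.Properties as AllPairs
open import Data.List.Relation.Unary.Any using (here; there)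
import Data.List.Relation.Unary.Any.Properties as Any
open import Data.List.Membership.Propositional using (_∈_)
open import Data.List.Membership.Propositional.Properties
open import Data.Product using (_×_; _,_; proj₁; proj₂; ∃-syntax; uncurry)
open import Data.Sum using (_⊎_; inj₁; inj₂)
open import Function using (_∘_)
open import Level using (0ℓ)
open import Relation.Binary using (Rel; Asymmetric; tri<; tri≈; tri>)
open import Relation.Nullary using (¬_; Dec; yes; no; contradiction; _×-dec_)
open import Relation.Nullary.Decidable using (¬?)
open import Relation.Binary.PropositionalEquality using (_≡_; _≢_; refl; sym; trans; cong; subst; subst₂; module ≡-Reasoning)

-- Reflection of positions

suc[m∸1]≡m : ∀ {m} → 1 ≤ m → suc (m ∸ 1) ≡ m
suc[m∸1]≡m {suc m} _ = refl

<⇒≤∸1 : ∀ {z m} → z < m → z ≤ m ∸ 1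
<⇒≤∸1 (s≤s z≤m) = z≤m

reflect : ℕ → ℕ → ℕ
reflect N i = suc N ∸ i

module _ {N : ℕ} where

  reflect-involutive : ∀ {i} → i ≤ N → reflect N (reflect N i) ≡ i
  reflect-involutive i≤N = m∸[m∸n]≡n (m≤n⇒m≤1+n i≤N)

  reflect-range : ∀ {i} → 1 ≤ i → i ≤ N → 1 ≤ reflect N i × reflect N i ≤ N
  reflect-range {suc k} _ i≤N = n≢0⇒n>0 (m>n⇒m∸n≢0 (s≤s i≤N)) , m∸n≤m N k

  reflect-< : ∀ {i j} → i < j → j ≤ N → reflect N j < reflect N i
  reflect-< i<j j≤N = ∸-monoʳ-< i<j (m≤n⇒m≤1+n j≤N)

  reflect-last : reflect N N ≡ 1
  reflect-last = m+n∸n≡m 1 N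

  reflect-suc : ∀ {i} → i < N → reflect N i ≡ suc (reflect N (suc i))
  reflect-suc i<N = +-∸-assoc 1 (<⇒≤ i<N)

  reflect-injective : ∀ {i j} → i ≤ N → j ≤ N → reflect N i ≡ reflect N j → i ≡ j
  reflect-injective i≤N j≤N eq =
    trans (sym (reflect-involutive i≤N)) (trans (cong (reflect N) eq) (reflect-involutive j≤N))

  reflect-interior : ∀ {z} → 1 < z → z < N → 1 < reflect N z × reflect N z < N
  reflect-interior {z} 1<z z<N =
    subst (_< reflect N z) reflect-last (reflect-< z<N ≤-refl) , reflect-< 1<z (<⇒≤ z<N)

Sorted : List ℕ → Set
Sorted = AllPairs _<_

∈-range⁻ : ∀ {n z} → z ∈ range n → 1 ≤ z × z ≤ n
∈-range⁻ z∈ with ∈-map⁻ suc z∈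
... | t , t∈ , refl = z<s , ∈-upTo⁻ t∈

∈-range⁺ : ∀ {n z} → 1 ≤ z → z ≤ n → z ∈ range n
∈-range⁺ {z = suc t} _ t<n = ∈-map⁺ suc (∈-upTo⁺ t<n)

∈-rangeFromTo⁻ : ∀ {a b z} → z ∈ rangeFromTo a b → a ≤ z × z ≤ b
∈-rangeFromTo⁻ {a} {b} z∈ with ∈-map⁻ (a +_) z∈
... | t , t∈ , refl = m≤m+n a t , ≤-pred (subst (_≤ suc b) (cong suc (+-comm t a)) a+t<1+b)
  where
  t<1+b∸a : t < suc b ∸ a
  t<1+b∸a = ∈-upTo⁻ t∈
  a+t<1+b : suc t + a ≤ suc b
  a+t<1+b = m≤o∸n⇒m+n≤o (suc t) (<⇒≤ (m∸n≢0⇒n<m (m<n⇒n≢0 t<1+b∸a))) t<1+b∸a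

∈-rangeFromTo⁺ : ∀ {a b z} → a ≤ z → z ≤ b → z ∈ rangeFromTo a b
∈-rangeFromTo⁺ {a} {b} a≤z z≤b =
  subst (_∈ rangeFromTo a b) (m+[n∸m]≡n a≤z) (∈-map⁺ (a +_) (∈-upTo⁺ (∸-monoˡ-< (s≤s z≤b) a≤z)))

range-sorted : ∀ n → Sorted (range n)
range-sorted n = AllPairs.map⁺ (AllPairs.applyUpTo⁺₁ _ n (λ i<j _ → s≤s i<j))

rangeFromTo-sorted : ∀ a b → Sorted (rangeFromTo a b)
rangeFromTo-sorted a b = AllPairs.map⁺ (AllPairs.applyUpTo⁺₁ _ _ (λ i<j _ → +-monoʳ-< a i<j))

module _ {R : Rel ℕ 0ℓ} where

  AllPairs-reverse : ∀ {xs} → AllPairs R xs → AllPairs (λ x y → R y x) (reverse xs)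
  AllPairs-reverse [] = []
  AllPairs-reverse {x ∷ xs} (Rx ∷ Rxs) rewrite unfold-reverse x xs =
    AllPairs.++⁺ (AllPairs-reverse Rxs) ([] ∷ [])
      (All.tabulate λ y∈ → All.lookup Rx (Any.reverse⁻ y∈) ∷ [])

  AllPairs-map-on : ∀ {S : Rel ℕ 0ℓ} (f : ℕ → ℕ) {xs} →
    (∀ {p q} → p ∈ xs → q ∈ xs → R p q → S (f p) (f q)) → AllPairs R xs → AllPairs S (map f xs)
  AllPairs-map-on f mono [] = []
  AllPairs-map-on f mono (Rx ∷ Rxs) =
    All.map⁺ (All.tabulate λ q∈ → mono (here refl) (there q∈) (All.lookup Rx q∈)) ∷
    AllPairs-map-on f (λ p∈ q∈ → mono (there p∈) (there q∈)) Rxs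

  AllPairs-≡ : Asymmetric R → ∀ {xs ys} → AllPairs R xs → AllPairs R ys →
    (∀ {z} → z ∈ xs → z ∈ ys) → (∀ {z} → z ∈ ys → z ∈ xs) → xs ≡ ys
  AllPairs-≡ asym {[]} {[]} _ _ _ _ = refl
  AllPairs-≡ asym {[]} {y ∷ ys} _ _ _ ys⊆ with () ← ys⊆ (here refl)
  AllPairs-≡ asym {x ∷ xs} {[]} _ _ xs⊆ _ with () ← xs⊆ (here refl)
  AllPairs-≡ asym {x ∷ xs} {y ∷ ys} (Rx ∷ Rxs) (Ry ∷ Rys) xs⊆ ys⊆
    with heads (xs⊆ (here refl)) (ys⊆ (here refl))
    where
    heads : x ∈ y ∷ ys → y ∈ x ∷ xs → x ≡ y
    heads (here x≡y) _ = x≡y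
    heads (there _) (here y≡x) = sym y≡x
    heads (there x∈) (there y∈) = contradiction (All.lookup Rx y∈) (asym (All.lookup Ry x∈))
  ... | refl = cong (x ∷_) (AllPairs-≡ asym Rxs Rys (tail Rx xs⊆) (tail Ry ys⊆))
    where
    tail : ∀ {zs us} → All (R x) zs → (∀ {z} → z ∈ x ∷ zs → z ∈ x ∷ us) →
      ∀ {z} → z ∈ zs → z ∈ us
    tail Rx ⊆ z∈ with ⊆ (there z∈)
    ... | here refl = contradiction (All.lookup Rx z∈) (λ r → asym r r)
    ... | there z∈′ = z∈′

nth-∈ : ∀ xs {j} → j < length xs → nth xs j ∈ xs
nth-∈ (x ∷ xs) {zero} _ = here refl
nth-∈ (x ∷ xs) {suc j} j<len = there (nth-∈ xs (≤-pred j<len))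

∈⇒nth : ∀ {xs z} → z ∈ xs → ∃[ j ] j < length xs × nth xs j ≡ z
∈⇒nth (here refl) = 0 , z<s , refl
∈⇒nth (there z∈) with ∈⇒nth z∈
... | j , j<len , refl = suc j , s≤s j<len , refl

nth-map : ∀ (f : ℕ → ℕ) xs {j} → j < length xs → nth (map f xs) j ≡ f (nth xs j)
nth-map f (x ∷ xs) {zero} _ = refl
nth-map f (x ∷ xs) {suc j} j<len = nth-map f xs (≤-pred j<len)

nth-monotone : ∀ {xs i j} → Sorted xs → i < j → j < length xs → nth xs i < nth xs j
nth-monotone {x ∷ xs} {zero} {suc j} (x< ∷ _) _ j<len = All.lookup x< (nth-∈ xs (≤-pred j<len))
nth-monotone {x ∷ xs} {suc i} {suc j} (_ ∷ s) i<j j<len = nth-monotone s (≤-pred i<j) (≤-pred j<len)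

∈-take-sorted⁻ : ∀ {xs} → Sorted xs → ∀ k {z} → k < length xs → z ∈ take k xs → z ∈ xs × z < nth xs k
∈-take-sorted⁻ {x ∷ xs} (x< ∷ _) (suc k) k<len (here refl) = here refl , All.lookup x< (nth-∈ xs (≤-pred k<len))
∈-take-sorted⁻ {x ∷ xs} (_ ∷ s) (suc k) k<len (there z∈) with ∈-take-sorted⁻ s k (≤-pred k<len) z∈
... | z∈xs , z<xₖ = there z∈xs , z<xₖ

∈-take-sorted⁺ : ∀ {xs} → Sorted xs → ∀ k {z} → z ∈ xs → z < nth xs k → z ∈ take k xs
∈-take-sorted⁺ {x ∷ xs} _ zero (here refl) z<x = contradiction z<x (<-irrefl refl)
∈-take-sorted⁺ {x ∷ xs} (x< ∷ _) zero (there z∈) z<x = contradiction z<x (<-asym (All.lookup x< z∈))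
∈-take-sorted⁺ {x ∷ xs} _ (suc k) (here refl) _ = here refl
∈-take-sorted⁺ {x ∷ xs} (_ ∷ s) (suc k) (there z∈) z<xₖ = there (∈-take-sorted⁺ s k z∈ z<xₖ)

rank : (ℕ → ℕ) → List ℕ → ℕ → ℕ
rank f L u = length (filter (λ q → f q ≤? u) L)

module _ (f : ℕ → ℕ) where

  rank-accept : ∀ {x} L {u} → f x ≤ u → rank f (x ∷ L) u ≡ suc (rank f L u)
  rank-accept {x} L {u} = cong length ∘ filter-accept (λ q → f q ≤? u) {x} {L}

  rank-reject : ∀ {x} L {u} → ¬ f x ≤ u → rank f (x ∷ L) u ≡ rank f L u
  rank-reject {x} L {u} = cong length ∘ filter-reject (λ q → f q ≤? u) {x} {L}

  rank-mono : ∀ L {u u′} → u ≤ u′ → rank f L u ≤ rank f L u′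
  rank-mono [] _ = ≤-refl
  rank-mono (x ∷ L) {u} {u′} u≤u′ with f x ≤? u | f x ≤? u′
  ... | yes fx≤u | yes fx≤u′ rewrite rank-accept L fx≤u | rank-accept L fx≤u′ = s≤s (rank-mono L u≤u′)
  ... | yes fx≤u | no fx≰u′ = contradiction (≤-trans fx≤u u≤u′) fx≰u′
  ... | no fx≰u | yes fx≤u′ rewrite rank-reject L fx≰u | rank-accept L fx≤u′ = m≤n⇒m≤1+n (rank-mono L u≤u′)
  ... | no fx≰u | no fx≰u′ rewrite rank-reject L fx≰u | rank-reject L fx≰u′ = rank-mono L u≤u′

  rank-strict : ∀ L {u u′ q} → u < u′ → q ∈ L → f q ≡ u′ → rank f L u < rank f L u′
  rank-strict (x ∷ L) {u} {u′} u<u′ q∈ fq≡u′ with f x ≤? u | f x ≤? u′ | q∈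
  ... | yes fx≤u | no fx≰u′ | _ = contradiction (≤-trans fx≤u (<⇒≤ u<u′)) fx≰u′
  ... | yes fx≤u | yes _ | here refl = contradiction (≤-<-trans fx≤u u<u′) (<-irrefl fq≡u′)
  ... | yes fx≤u | yes fx≤u′ | there q∈L rewrite rank-accept L fx≤u | rank-accept L fx≤u′ =
    s≤s (rank-strict L u<u′ q∈L fq≡u′)
  ... | no fx≰u | yes fx≤u′ | _ rewrite rank-reject L fx≰u | rank-accept L fx≤u′ = s≤s (rank-mono L (<⇒≤ u<u′))
  ... | no _ | no fx≰u′ | here refl = contradiction (≤-reflexive fq≡u′) fx≰u′
  ... | no fx≰u | no fx≰u′ | there q∈L rewrite rank-reject L fx≰u | rank-reject L fx≰u′ =
    rank-strict L u<u′ q∈L fq≡u′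

-- Left-to-right and right-to-left maxima

lrMax⁻ : ∀ {w i} → LRMax w i → ∀ {m} → 1 ≤ m → m < i → w m < w i
lrMax⁻ {i = suc i} lr 1≤m m<i = All.lookup lr (∈-range⁺ 1≤m (≤-pred m<i))

lrMax⁺ : ∀ {w i} → (∀ {m} → 1 ≤ m → m < i → w m < w i) → LRMax w i
lrMax⁺ {i = zero} _ = []
lrMax⁺ {i = suc i} dom = All.tabulate λ m∈ → dom (proj₁ (∈-range⁻ m∈)) (s≤s (proj₂ (∈-range⁻ m∈)))

rlMax⁻ : ∀ {n w i} → RLMax n w i → ∀ {m} → i < m → m ≤ n → w m < w i
rlMax⁻ rl i<m m≤n = All.lookup rl (∈-rangeFromTo⁺ i<m m≤n)

rlMax⁺ : ∀ {n w i} → (∀ {m} → i < m → m ≤ n → w m < w i) → RLMax n w i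
rlMax⁺ dom = All.tabulate λ m∈ → dom (proj₁ (∈-rangeFromTo⁻ m∈)) (proj₂ (∈-rangeFromTo⁻ m∈))

rlMaxPositions↑ : ℕ → (ℕ → ℕ) → List ℕ
rlMaxPositions↑ n w = filter (rlMax? n w) (range n)

module _ (n : ℕ) (w : ℕ → ℕ) where

  ∈-lrMaxPositions⁻ : ∀ {z} → z ∈ lrMaxPositions n w → (1 ≤ z × z ≤ n) × LRMax w z
  ∈-lrMaxPositions⁻ z∈ with ∈-filter⁻ (lrMax? w) {xs = range n} z∈
  ... | z∈range , lr = ∈-range⁻ z∈range , lr

  ∈-lrMaxPositions⁺ : ∀ {i} → 1 ≤ i → i ≤ n → LRMax w i → i ∈ lrMaxPositions n w
  ∈-lrMaxPositions⁺ 1≤i i≤n = ∈-filter⁺ (lrMax? w) (∈-range⁺ {n} 1≤i i≤n)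

  lrMaxPositions-sorted : Sorted (lrMaxPositions n w)
  lrMaxPositions-sorted = AllPairs.filter⁺ (lrMax? w) (range-sorted n)

  ∈-rlMaxPositions↑⁻ : ∀ {z} → z ∈ rlMaxPositions↑ n w → (1 ≤ z × z ≤ n) × RLMax n w z
  ∈-rlMaxPositions↑⁻ z∈ with ∈-filter⁻ (rlMax? n w) {xs = range n} z∈
  ... | z∈range , rl = ∈-range⁻ z∈range , rl

  ∈-rlMaxPositions↑⁺ : ∀ {i} → 1 ≤ i → i ≤ n → RLMax n w i → i ∈ rlMaxPositions↑ n w
  ∈-rlMaxPositions↑⁺ 1≤i i≤n = ∈-filter⁺ (rlMax? n w) (∈-range⁺ {n} 1≤i i≤n)

  rlMaxPositions↑-sorted : Sorted (rlMaxPositions↑ n w)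
  rlMaxPositions↑-sorted = AllPairs.filter⁺ (rlMax? n w) (range-sorted n)

module _ (n : ℕ) (w : ℕ → ℕ) where

  private
    w∘reflect : ℕ → ℕ
    w∘reflect j = w (reflect n j)

  rlMax⇒reflect-lrMax : ∀ {p} → 1 ≤ p → p ≤ n → RLMax n w p → LRMax w∘reflect (reflect n p)
  rlMax⇒reflect-lrMax {p} 1≤p p≤n rl = lrMax⁺ λ {m} 1≤m m<ρp →
    subst (λ t → w (reflect n m) < w t) (sym (reflect-involutive p≤n))
      (rlMax⁻ rl (subst (_< reflect n m) (reflect-involutive p≤n) (reflect-< m<ρp ρp≤n))
                 (proj₂ (reflect-range 1≤m (≤-trans (<⇒≤ m<ρp) ρp≤n))))
    where
    ρp≤n : reflect n p ≤ n
    ρp≤n = proj₂ (reflect-range 1≤p p≤n)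

  reflect-lrMax⇒rlMax : ∀ {p} → p ≤ n → LRMax w∘reflect p → RLMax n w (reflect n p)
  reflect-lrMax⇒rlMax {p} p≤n lr = rlMax⁺ λ {m} ρp<m m≤n →
    subst (_< w (reflect n p)) (cong w (reflect-involutive m≤n))
      (lrMax⁻ lr (proj₁ (reflect-range (≤-trans z<s ρp<m) m≤n))
                 (subst (reflect n m <_) (reflect-involutive p≤n) (reflect-< ρp<m m≤n)))

  rlMaxPositions-reflect : rlMaxPositions n w ≡ map (reflect n) (lrMaxPositions n w∘reflect)
  rlMaxPositions-reflect = AllPairs-≡ (λ x<y y<x → <-asym y<x x<y)
    (AllPairs-reverse (rlMaxPositions↑-sorted n w))
    (AllPairs-map-on (reflect n) (λ _ q∈ p<q → reflect-< p<q (proj₂ (proj₁ (∈-lrMaxPositions⁻ n w∘reflect q∈))))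
      (lrMaxPositions-sorted n w∘reflect))
    ⊆ ⊇
    where
    ⊆ : ∀ {z} → z ∈ rlMaxPositions n w → z ∈ map (reflect n) (lrMaxPositions n w∘reflect)
    ⊆ z∈ with ∈-rlMaxPositions↑⁻ n w (Any.reverse⁻ z∈)
    ... | (1≤p , p≤n) , rl = subst (_∈ map (reflect n) (lrMaxPositions n w∘reflect)) (reflect-involutive p≤n)
      (∈-map⁺ (reflect n) (uncurry (∈-lrMaxPositions⁺ n w∘reflect) (reflect-range {n} 1≤p p≤n)
                             (rlMax⇒reflect-lrMax 1≤p p≤n rl)))
    ⊇ : ∀ {z} → z ∈ map (reflect n) (lrMaxPositions n w∘reflect) → z ∈ rlMaxPositions n w
    ⊇ z∈ with ∈-map⁻ (reflect n) z∈
    ... | p , p∈ , refl with ∈-lrMaxPositions⁻ n w∘reflect p∈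
    ...   | (1≤p , p≤n) , lr =
      Any.reverse⁺ (uncurry (∈-rlMaxPositions↑⁺ n w) (reflect-range 1≤p p≤n) (reflect-lrMax⇒rlMax p≤n lr))

-- Rotation-invariant permutations

module Permutation {N : ℕ} {v : ℕ → ℕ} (perm : IsPerm N v) where

  bounded : ∀ {i} → 1 ≤ i → i ≤ N → 1 ≤ v i × v i ≤ N
  bounded = proj₁ perm _

  injective : ∀ {i j} → 1 ≤ i → i ≤ N → 1 ≤ j → j ≤ N → v i ≡ v j → i ≡ j
  injective = proj₂ perm _ _

  reflect-isPerm : IsPerm N (λ i → v (reflect N i))
  reflect-isPerm = (λ i 1≤i i≤N → uncurry bounded (reflect-range 1≤i i≤N)) ,
    λ i j 1≤i i≤N 1≤j j≤N eq → reflect-injective i≤N j≤N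
      (uncurry (uncurry injective (reflect-range 1≤i i≤N)) (reflect-range 1≤j j≤N) eq)

module RotationFixed {N : ℕ} {v : ℕ → ℕ} (perm : IsPerm N v) (rot : RotFixed N v) where

  open Permutation perm

  reflect-inverse : ∀ {z} → 1 ≤ z → z ≤ N → v (reflect N (v z)) ≡ z
  reflect-inverse {z} 1≤z z≤N = begin
    v (reflect N (v z))     ≡⟨ cong v (sym (rot (v z) 1≤vz vz≤N)) ⟩
    v (v (v (v z)))         ≡⟨ cong (λ t → v (v t)) (rot z 1≤z z≤N) ⟩
    v (v (reflect N z))     ≡⟨ uncurry (rot (reflect N z)) (reflect-range 1≤z z≤N) ⟩
    reflect N (reflect N z) ≡⟨ reflect-involutive z≤N ⟩
    z                       ∎
    where
    open ≡-Reasoning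
    1≤vz : 1 ≤ v z
    1≤vz = proj₁ (bounded 1≤z z≤N)
    vz≤N : v z ≤ N
    vz≤N = proj₂ (bounded 1≤z z≤N)

  reflect-rotFixed : RotFixed N (λ i → v (reflect N i))
  reflect-rotFixed i 1≤i i≤N = uncurry reflect-inverse (reflect-range 1≤i i≤N)

  maximum-position : ∀ {q} → 1 ≤ q → q ≤ N → v q ≡ N → q ≡ v 1
  maximum-position 1≤q q≤N vq≡N =
    uncurry (injective 1≤q q≤N) (bounded ≤-refl 1≤N) (trans vq≡N (sym (rot 1 ≤-refl 1≤N)))
    where 1≤N = ≤-trans 1≤q q≤N

  last-value : 1 ≤ N → v N ≡ reflect N (v 1)
  last-value 1≤N = trans (cong v (sym (rot 1 ≤-refl 1≤N))) (uncurry (rot (v 1)) (bounded ≤-refl 1≤N))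

  lrMax⇒rlMax : ∀ {p} → 1 ≤ p → p ≤ N → LRMax v p → RLMax N v (v p)
  lrMax⇒rlMax {p} 1≤p p≤N lr = rlMax⁺ dominated
    where
    dominated : ∀ {q} → v p < q → q ≤ N → v q < v (v p)
    dominated {q} vp<q q≤N = subst₂ _<_ (trans (sym (rot p′ 1≤p′ p′≤N)) (cong v vp′≡q)) (sym (rot p 1≤p p≤N))
                               (reflect-< p<p′ p′≤N)
      where
      1≤q : 1 ≤ q
      1≤q = ≤-trans z<s vp<q
      p′ : ℕ
      p′ = reflect N (v q)
      1≤p′ : 1 ≤ p′
      1≤p′ = proj₁ (uncurry reflect-range (bounded 1≤q q≤N))
      p′≤N : p′ ≤ N
      p′≤N = proj₂ (uncurry reflect-range (bounded 1≤q q≤N))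
      vp′≡q : v p′ ≡ q
      vp′≡q = reflect-inverse 1≤q q≤N
      p<p′ : p < p′
      p<p′ = ≤∧≢⇒< (≮⇒≥ λ p′<p → <-asym vp<q (subst (_< v p) vp′≡q (lrMax⁻ lr 1≤p′ p′<p)))
                   (λ p≡p′ → <-irrefl (trans (cong v p≡p′) vp′≡q) vp<q)

  rlMax⇒lrMax : ∀ {z} → 1 ≤ z → z ≤ N → RLMax N v z → LRMax v (reflect N (v z))
  rlMax⇒lrMax {z} 1≤z z≤N rl = lrMax⁺ dominated
    where
    p : ℕ
    p = reflect N (v z)
    vz≤N : v z ≤ N
    vz≤N = proj₂ (bounded 1≤z z≤N)
    1≤p : 1 ≤ p
    1≤p = proj₁ (uncurry reflect-range (bounded 1≤z z≤N))
    p≤N : p ≤ N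
    p≤N = proj₂ (uncurry reflect-range (bounded 1≤z z≤N))
    vp≡z : v p ≡ z
    vp≡z = reflect-inverse 1≤z z≤N
    dominated : ∀ {q} → 1 ≤ q → q < p → v q < v p
    dominated {q} 1≤q q<p = subst (v q <_) (sym vp≡z) (≤∧≢⇒< (≮⇒≥ z≮vq) vq≢z)
      where
      q≤N : q ≤ N
      q≤N = ≤-trans (<⇒≤ q<p) p≤N
      vq≢z : v q ≢ z
      vq≢z vq≡z = <-irrefl (injective 1≤q q≤N 1≤p p≤N (trans vq≡z (sym vp≡z))) q<p
      z≮vq : ¬ (z < v q)
      z≮vq z<vq = <-asym q<p (∸-cancelʳ-< (subst₂ _<_ (rot q 1≤q q≤N) (sym (reflect-involutive vz≤N))
                    (rlMax⁻ rl z<vq (proj₂ (bounded 1≤q q≤N)))))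

  lrMaxPositions-image : map v (lrMaxPositions N v) ≡ rlMaxPositions↑ N v
  lrMaxPositions-image = AllPairs-≡ <-asym image-sorted (rlMaxPositions↑-sorted N v) image⊆ image⊇
    where
    image-sorted : Sorted (map v (lrMaxPositions N v))
    image-sorted = AllPairs-map-on v
      (λ p∈ q∈ → lrMax⁻ (proj₂ (∈-lrMaxPositions⁻ N v q∈)) (proj₁ (proj₁ (∈-lrMaxPositions⁻ N v p∈))))
      (lrMaxPositions-sorted N v)
    image⊆ : ∀ {z} → z ∈ map v (lrMaxPositions N v) → z ∈ rlMaxPositions↑ N v
    image⊆ z∈ with ∈-map⁻ v z∈
    ... | p , p∈ , refl with ∈-lrMaxPositions⁻ N v p∈
    ...   | (1≤p , p≤N) , lr = uncurry (∈-rlMaxPositions↑⁺ N v) (bounded 1≤p p≤N) (lrMax⇒rlMax 1≤p p≤N lr)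
    image⊇ : ∀ {z} → z ∈ rlMaxPositions↑ N v → z ∈ map v (lrMaxPositions N v)
    image⊇ z∈ with ∈-rlMaxPositions↑⁻ N v z∈
    ... | (1≤z , z≤N) , rl = subst (_∈ map v (lrMaxPositions N v)) (reflect-inverse 1≤z z≤N)
      (∈-map⁺ v (uncurry (∈-lrMaxPositions⁺ N v) (uncurry reflect-range (bounded 1≤z z≤N))
                   (rlMax⇒lrMax 1≤z z≤N rl)))

  lrMax-count≡rlMax-count : length (lrMaxPositions N v) ≡ length (rlMaxPositions N v)
  lrMax-count≡rlMax-count = begin
    length (lrMaxPositions N v)           ≡⟨ sym (length-map v (lrMaxPositions N v)) ⟩
    length (map v (lrMaxPositions N v))   ≡⟨ cong length lrMaxPositions-image ⟩
    length (rlMaxPositions↑ N v)          ≡⟨ sym (length-reverse (rlMaxPositions↑ N v)) ⟩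
    length (rlMaxPositions N v)           ∎
    where open ≡-Reasoning

-- Occurrences of a pattern on the surviving positions

record Kept (N : ℕ) (v : ℕ → ℕ) (z : ℕ) : Set where
  field
    after-first : 1 < z
    before-last : z < N
    value≢1     : v z ≢ 1
    value≢N     : v z ≢ N

record Occurrence (n N : ℕ) (w v : ℕ → ℕ) : Set where
  field
    pos             : ℕ → ℕ
    pos-monotone    : ∀ {j j′} → 1 ≤ j → j′ ≤ n → j < j′ → pos j < pos j′
    pos-kept        : ∀ {j} → 1 ≤ j → j ≤ n → Kept N v (pos j)
    pos-onto        : ∀ {z} → Kept N v z → ∃[ j ] (1 ≤ j × j ≤ n) × pos j ≡ z
    pos-preserves-< : ∀ {j j′} → 1 ≤ j → j ≤ n → 1 ≤ j′ → j′ ≤ n → w j < w j′ → v (pos j) < v (pos j′)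
    pos-reflects-<  : ∀ {j j′} → 1 ≤ j → j ≤ n → 1 ≤ j′ → j′ ≤ n → v (pos j) < v (pos j′) → w j < w j′

  pos-reflects-index : ∀ {j j′} → 1 ≤ j → j ≤ n → 1 ≤ j′ → j′ ≤ n → pos j < pos j′ → j < j′
  pos-reflects-index {j} {j′} 1≤j j≤n 1≤j′ j′≤n lt with <-cmp j j′
  ... | tri< j<j′ _ _ = j<j′
  ... | tri≈ _ refl _ = contradiction lt (<-irrefl refl)
  ... | tri> _ _ j′<j = contradiction lt (<-asym (pos-monotone 1≤j′ j≤n j′<j))

  lrMax-restrict : ∀ {j} → 1 ≤ j → j ≤ n → LRMax w j → ∀ {q} → Kept N v q → q < pos j → v q < v (pos j)
  lrMax-restrict 1≤j j≤n lr kq q<pos with pos-onto kq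
  ... | j′ , (1≤j′ , j′≤n) , refl =
    pos-preserves-< 1≤j′ j′≤n 1≤j j≤n (lrMax⁻ lr 1≤j′ (pos-reflects-index 1≤j′ j′≤n 1≤j j≤n q<pos))

  lrMax-extend : ∀ {j} → 1 ≤ j → j ≤ n → (∀ {q} → Kept N v q → q < pos j → v q < v (pos j)) → LRMax w j
  lrMax-extend 1≤j j≤n dom = lrMax⁺ λ 1≤m m<j →
    pos-reflects-< 1≤m (≤-trans (<⇒≤ m<j) j≤n) 1≤j j≤n
      (dom (pos-kept 1≤m (≤-trans (<⇒≤ m<j) j≤n)) (pos-monotone 1≤m j≤n m<j))

module _ (N : ℕ) (v : ℕ → ℕ) where

  private
    survives? : (p : ℕ) → Dec (¬ v p ≡ 1 × ¬ v p ≡ N)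
    survives? p = ¬? (v p ≟ 1) ×-dec ¬? (v p ≟ N)

  ∈-keptPositions⁻ : ∀ {z} → 1 ≤ N → z ∈ keptPositions N v → Kept N v z
  ∈-keptPositions⁻ {z} 1≤N z∈ with ∈-filter⁻ survives? {xs = rangeFromTo 2 (N ∸ 1)} z∈
  ... | z∈range , v≢1 , v≢N = record
    { after-first = proj₁ bounds
    ; before-last = ≤-<-trans (proj₂ bounds) (≤-reflexive (suc[m∸1]≡m 1≤N))
    ; value≢1 = v≢1
    ; value≢N = v≢N
    }
    where
    bounds : 2 ≤ z × z ≤ N ∸ 1
    bounds = ∈-rangeFromTo⁻ {2} {N ∸ 1} z∈range

  ∈-keptPositions⁺ : ∀ {z} → Kept N v z → z ∈ keptPositions N v
  ∈-keptPositions⁺ kz = ∈-filter⁺ survives? (∈-rangeFromTo⁺ after-first (<⇒≤∸1 before-last)) (value≢1 , value≢N)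
    where open Kept kz

  keptPositions-sorted : Sorted (keptPositions N v)
  keptPositions-sorted = AllPairs.filter⁺ survives? (rangeFromTo-sorted 2 (N ∸ 1))

deletesTo-occurrence : ∀ {n w w′} → DeletesTo n w′ w → Occurrence n (n + 4) w w′
deletesTo-occurrence {n} {w} {w′} (length≡n , standardize≡) = record
  { pos             = origin n w′
  ; pos-monotone    = monotone
  ; pos-kept        = kept
  ; pos-onto        = onto
  ; pos-preserves-< = preserves
  ; pos-reflects-<  = λ {j} {j′} 1≤j j≤n 1≤j′ j′≤n lt →
      subst₂ _<_ (standardize≡ j 1≤j j≤n) (standardize≡ j′ 1≤j′ j′≤n)
        (rank-strict w′ K lt (∈-keptPositions⁺ (n + 4) w′ (kept 1≤j′ j′≤n)) refl)
  }
  where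
  K : List ℕ
  K = keptPositions (n + 4) w′
  1≤N : 1 ≤ n + 4
  1≤N = ≤-trans z<s (m≤n+m 4 n)
  index : ∀ {j} → suc j ≤ n → j < length K
  index j<n = subst (_ <_) (sym length≡n) j<n
  monotone : ∀ {j j′} → 1 ≤ j → j′ ≤ n → j < j′ → origin n w′ j < origin n w′ j′
  monotone {suc j} {suc j′} _ j′≤n j<j′ =
    nth-monotone (keptPositions-sorted (n + 4) w′) (≤-pred j<j′) (index j′≤n)
  kept : ∀ {j} → 1 ≤ j → j ≤ n → Kept (n + 4) w′ (origin n w′ j)
  kept {suc j} _ j≤n = ∈-keptPositions⁻ (n + 4) w′ 1≤N (nth-∈ K (index j≤n))
  onto : ∀ {z} → Kept (n + 4) w′ z → ∃[ j ] (1 ≤ j × j ≤ n) × origin n w′ j ≡ z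
  onto kz with ∈⇒nth (∈-keptPositions⁺ (n + 4) w′ kz)
  ... | t , t<len , nth≡z = suc t , (z<s , subst (t <_) length≡n t<len) , nth≡z
  preserves : ∀ {j j′} → 1 ≤ j → j ≤ n → 1 ≤ j′ → j′ ≤ n → w j < w j′ →
    w′ (origin n w′ j) < w′ (origin n w′ j′)
  preserves {j} {j′} 1≤j j≤n 1≤j′ j′≤n lt with w′ (origin n w′ j) <? w′ (origin n w′ j′)
  ... | yes lt′ = lt′
  ... | no ≮ = contradiction (subst₂ _≤_ (standardize≡ j′ 1≤j′ j′≤n) (standardize≡ j 1≤j j≤n)
                  (rank-mono w′ K (≮⇒≥ ≮))) (<⇒≱ lt)

module _ {N : ℕ} {v : ℕ → ℕ} where

  Kept-reflect⁺ : ∀ {z} → Kept N v z → Kept N (λ i → v (reflect N i)) (reflect N z)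
  Kept-reflect⁺ {z} kz = record
    { after-first = proj₁ (reflect-interior after-first before-last)
    ; before-last = proj₂ (reflect-interior after-first before-last)
    ; value≢1     = value≢1 ∘ trans (sym v∘reflect²≡v)
    ; value≢N     = value≢N ∘ trans (sym v∘reflect²≡v)
    }
    where
    open Kept kz
    v∘reflect²≡v : v (reflect N (reflect N z)) ≡ v z
    v∘reflect²≡v = cong v (reflect-involutive (<⇒≤ before-last))

  Kept-reflect⁻ : ∀ {z} → Kept N (λ i → v (reflect N i)) z → Kept N v (reflect N z)
  Kept-reflect⁻ kz = record
    { after-first = proj₁ (reflect-interior after-first before-last)
    ; before-last = proj₂ (reflect-interior after-first before-last)
    ; value≢1     = value≢1
    ; value≢N     = value≢N
    }
    where open Kept kz

reflect-occurrence : ∀ {n N w v} → Occurrence n N w v →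
  Occurrence n N (λ j → w (reflect n j)) (λ i → v (reflect N i))
reflect-occurrence {n} {N} {w} {v} occ = record
  { pos             = pos′
  ; pos-monotone    = monotone
  ; pos-kept        = λ 1≤j j≤n → Kept-reflect⁺ (uncurry pos-kept (ρ 1≤j j≤n))
  ; pos-onto        = onto
  ; pos-preserves-< = λ 1≤j j≤n 1≤j′ j′≤n lt →
      subst₂ _<_ (sym (v∘reflect² 1≤j j≤n)) (sym (v∘reflect² 1≤j′ j′≤n))
        (uncurry (uncurry pos-preserves-< (ρ 1≤j j≤n)) (ρ 1≤j′ j′≤n) lt)
  ; pos-reflects-<  = λ 1≤j j≤n 1≤j′ j′≤n lt →
      uncurry (uncurry pos-reflects-< (ρ 1≤j j≤n)) (ρ 1≤j′ j′≤n)
        (subst₂ _<_ (v∘reflect² 1≤j j≤n) (v∘reflect² 1≤j′ j′≤n) lt)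
  }
  where
  open Occurrence occ
  pos′ : ℕ → ℕ
  pos′ j = reflect N (pos (reflect n j))
  ρ : ∀ {j} → 1 ≤ j → j ≤ n → 1 ≤ reflect n j × reflect n j ≤ n
  ρ = reflect-range
  pos<N : ∀ {j} → 1 ≤ j → j ≤ n → pos j < N
  pos<N 1≤j j≤n = Kept.before-last (pos-kept 1≤j j≤n)
  monotone : ∀ {j j′} → 1 ≤ j → j′ ≤ n → j < j′ → pos′ j < pos′ j′
  monotone {j} {j′} 1≤j j′≤n j<j′ =
    reflect-< (pos-monotone (proj₁ ρj′) (proj₂ ρj) (reflect-< j<j′ j′≤n)) (<⇒≤ (uncurry pos<N ρj))
    where
    ρj : 1 ≤ reflect n j × reflect n j ≤ n
    ρj = ρ 1≤j (≤-trans (<⇒≤ j<j′) j′≤n)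
    ρj′ : 1 ≤ reflect n j′ × reflect n j′ ≤ n
    ρj′ = ρ (≤-trans 1≤j (<⇒≤ j<j′)) j′≤n
  v∘reflect² : ∀ {j} → 1 ≤ j → j ≤ n → v (reflect N (pos′ j)) ≡ v (pos (reflect n j))
  v∘reflect² 1≤j j≤n = cong v (reflect-involutive (<⇒≤ (uncurry pos<N (ρ 1≤j j≤n))))
  onto : ∀ {z} → Kept N (λ i → v (reflect N i)) z → ∃[ j ] (1 ≤ j × j ≤ n) × pos′ j ≡ z
  onto {z} kz with pos-onto (Kept-reflect⁻ kz)
  ... | j , (1≤j , j≤n) , pos≡ = reflect n j , ρ 1≤j j≤n , (begin
    reflect N (pos (reflect n (reflect n j))) ≡⟨ cong (reflect N ∘ pos) (reflect-involutive j≤n) ⟩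
    reflect N (pos j)                         ≡⟨ cong (reflect N) pos≡ ⟩
    reflect N (reflect N z)                   ≡⟨ reflect-involutive (<⇒≤ (Kept.before-last kz)) ⟩
    z                                         ∎)
    where open ≡-Reasoning

-- Inserting the maximum next to a left-to-right maximum

-- The maximum N sits at position a = v 1, immediately left of the entry coming from
-- x = nth F i, the (i+1)-st left-to-right maximum of w (nth counts from 0).
module InsertedMaximum {n N : ℕ} {w v : ℕ → ℕ} (perm : IsPerm N v)
  (v[v1]≡N : v (v 1) ≡ N) (v[v2]≡N∸1 : v (v 2) ≡ N ∸ 1) (occ : Occurrence n N w v)
  (i : ℕ) (i<k : i < length (lrMaxPositions n w))
  (adjacent : Occurrence.pos occ (nth (lrMaxPositions n w) i) ≡ suc (v 1)) where

  open Permutation perm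
  open Occurrence occ

  F : List ℕ
  F = lrMaxPositions n w
  x : ℕ
  x = nth F i
  x′ : ℕ
  x′ = pos x
  a : ℕ
  a = v 1

  x-bounds : 1 ≤ x × x ≤ n
  x-bounds = proj₁ (∈-lrMaxPositions⁻ n w (nth-∈ F i<k))

  x-lrMax : LRMax w x
  x-lrMax = proj₂ (∈-lrMaxPositions⁻ n w (nth-∈ F i<k))

  x′-kept : Kept N v x′
  x′-kept = uncurry pos-kept x-bounds

  a<N∸1 : a < N ∸ 1
  a<N∸1 = <⇒≤∸1 (subst (_< N) adjacent (Kept.before-last x′-kept))

  1≤N : 1 ≤ N
  1≤N = <⇒≤ (<-trans (Kept.after-first x′-kept) (Kept.before-last x′-kept))

  a-bounds : 1 ≤ a × a ≤ N
  a-bounds = bounded ≤-refl 1≤N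

  maximum-at-a : ∀ {q} → 1 ≤ q → q ≤ N → v q ≡ N → q ≡ a
  maximum-at-a 1≤q q≤N vq≡N = uncurry (injective 1≤q q≤N) a-bounds (trans vq≡N (sym v[v1]≡N))

  1<a : 1 < a
  1<a = ≤∧≢⇒< (proj₁ a-bounds) λ 1≡a → <-irrefl (1≡N 1≡a) 1<N
    where
    1<N : 1 < N
    1<N = ≤-<-trans (proj₁ a-bounds) (<-≤-trans a<N∸1 (m∸n≤m N 1))
    1≡N : 1 ≡ a → 1 ≡ N
    1≡N 1≡a = trans 1≡a (trans (cong v 1≡a) v[v1]≡N)

  N∸1<N : N ∸ 1 < N
  N∸1<N = ≤-reflexive (suc[m∸1]≡m 1≤N)

  kept-intro : ∀ {q} → 1 < q → q < N → v q ≢ 1 → q ≢ a → Kept N v q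
  kept-intro 1<q q<N vq≢1 q≢a = record
    { after-first = 1<q
    ; before-last = q<N
    ; value≢1     = vq≢1
    ; value≢N     = q≢a ∘ maximum-at-a (<⇒≤ 1<q) (<⇒≤ q<N)
    }

  a<v2 : a < v 2
  a<v2 with a <? v 2
  ... | yes a<v2 = a<v2
  ... | no a≮v2 = contradiction
        (≤-antisym (proj₂ (uncurry bounded x′-bounds)) (subst (_≤ v x′) (suc[m∸1]≡m 1≤N) N∸1<v[x′]))
        (Kept.value≢N x′-kept)
    where
    b : ℕ
    b = v 2
    2≤N : 2 ≤ N
    2≤N = ≤-trans (Kept.after-first x′-kept) (<⇒≤ (Kept.before-last x′-kept))
    x′-bounds : 1 ≤ x′ × x′ ≤ N
    x′-bounds = <⇒≤ (Kept.after-first x′-kept) , <⇒≤ (Kept.before-last x′-kept)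
    b<a : b < a
    b<a = ≤∧≢⇒< (≮⇒≥ a≮v2) λ b≡a →
      <-irrefl (trans (sym v[v2]≡N∸1) (trans (cong v b≡a) v[v1]≡N)) N∸1<N
    1<b : 1 < b
    1<b = ≤∧≢⇒< (proj₁ (bounded z<s 2≤N)) λ 1≡b →
      <-irrefl (trans (cong v 1≡b) v[v2]≡N∸1) a<N∸1
    kept-b : Kept N v b
    kept-b = kept-intro 1<b (<-≤-trans b<a (proj₂ a-bounds))
      (λ vb≡1 → <-irrefl (sym (trans (sym v[v2]≡N∸1) vb≡1)) (≤-<-trans (proj₁ a-bounds) a<N∸1))
      (<⇒≢ b<a)
    N∸1<v[x′] : N ∸ 1 < v x′
    N∸1<v[x′] = subst (_< v x′) v[v2]≡N∸1
      (lrMax-restrict (proj₁ x-bounds) (proj₂ x-bounds) x-lrMax kept-b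
        (<-trans b<a (subst (a <_) (sym adjacent) (n<1+n a))))

  earlier : List ℕ
  earlier = map pos (take i F)

  ∈-earlier⁻ : ∀ {z} → z ∈ earlier → ∃[ j ] ((1 ≤ j × j ≤ n) × LRMax w j × j < x) × pos j ≡ z
  ∈-earlier⁻ z∈ with ∈-map⁻ pos z∈
  ... | j , j∈take , refl with ∈-take-sorted⁻ (lrMaxPositions-sorted n w) i i<k j∈take
  ...   | j∈F , j<x = j , (proj₁ (∈-lrMaxPositions⁻ n w j∈F) , proj₂ (∈-lrMaxPositions⁻ n w j∈F) , j<x) , refl

  earlier-kept : ∀ {z} → z ∈ earlier → Kept N v z × z < a
  earlier-kept z∈ with ∈-earlier⁻ z∈
  ... | j , ((1≤j , j≤n) , _ , j<x) , refl = kept , ≤∧≢⇒< (≤-pred pos<x′) (Kept.value≢N kept ∘ value-N)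
    where
    kept : Kept N v (pos j)
    kept = pos-kept 1≤j j≤n
    pos<x′ : pos j < suc a
    pos<x′ = subst (pos j <_) adjacent (pos-monotone 1≤j (proj₂ x-bounds) j<x)
    value-N : pos j ≡ a → v (pos j) ≡ N
    value-N pos≡a = trans (cong v pos≡a) v[v1]≡N

  -- Position 1 is handled by v 1 = a < v 2, and the entries 1 and N cannot block pos j.
  earlier-lrMax : ∀ {z} → z ∈ earlier → LRMax v z
  earlier-lrMax z∈ with ∈-earlier⁻ z∈ | earlier-kept z∈
  ... | j , ((1≤j , j≤n) , lr , _) , refl | kept , z<a = lrMax⁺ dominates
    where
    open Kept kept
    below : ∀ {q} → Kept N v q → q < pos j → v q < v (pos j)
    below = lrMax-restrict 1≤j j≤n lr
    v2≤vz : v 2 ≤ v (pos j)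
    v2≤vz with 2 ≟ pos j
    ... | yes 2≡z = ≤-reflexive (cong v 2≡z)
    ... | no 2≢z = <⇒≤ (below (kept-intro ≤-refl (<-trans 2<z before-last)
                                 (λ v2≡1 → <-irrefl (sym v2≡1) (≤-<-trans (proj₁ a-bounds) a<v2))
                                 (<⇒≢ (<-trans 2<z z<a)))
                            2<z)
      where
      2<z : 2 < pos j
      2<z = ≤∧≢⇒< after-first 2≢z
    dominates : ∀ {q} → 1 ≤ q → q < pos j → v q < v (pos j)
    dominates {q} 1≤q q<z with q ≟ 1 | v q ≟ 1
    ... | yes refl | _ = <-≤-trans a<v2 v2≤vz
    ... | no _ | yes vq≡1 = subst (_< v (pos j)) (sym vq≡1)
                              (≤∧≢⇒< (proj₁ (bounded (<⇒≤ after-first) (<⇒≤ before-last))) (value≢1 ∘ sym))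
    ... | no q≢1 | no vq≢1 =
      below (kept-intro (≤∧≢⇒< 1≤q (q≢1 ∘ sym)) (<-trans q<z before-last) vq≢1 (<⇒≢ (<-trans q<z z<a))) q<z

  expected : List ℕ
  expected = 1 ∷ (earlier ++ [ a ])

  expected-sorted : Sorted expected
  expected-sorted =
    All.++⁺ (All.tabulate (Kept.after-first ∘ proj₁ ∘ earlier-kept)) (1<a ∷ []) ∷
    AllPairs.++⁺ earlier-sorted ([] ∷ []) (All.tabulate λ z∈ → proj₂ (earlier-kept z∈) ∷ [])
    where
    bounds : ∀ {j} → j ∈ take i F → 1 ≤ j × j ≤ n
    bounds j∈ = proj₁ (∈-lrMaxPositions⁻ n w (proj₁ (∈-take-sorted⁻ (lrMaxPositions-sorted n w) i i<k j∈)))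
    earlier-sorted : Sorted earlier
    earlier-sorted = AllPairs-map-on pos (λ p∈ q∈ → pos-monotone (proj₁ (bounds p∈)) (proj₂ (bounds q∈)))
      (AllPairs.take⁺ i (lrMaxPositions-sorted n w))

  expected-length : length expected ≡ suc (suc i)
  expected-length = cong suc (begin
    length (earlier ++ [ a ])    ≡⟨ length-++ earlier ⟩
    length earlier + 1           ≡⟨ cong (_+ 1) (length-map pos (take i F)) ⟩
    length (take i F) + 1        ≡⟨ cong (_+ 1) (length-take i F) ⟩
    (i ⊓ length F) + 1           ≡⟨ cong (_+ 1) (m≤n⇒m⊓n≡m (<⇒≤ i<k)) ⟩
    i + 1                        ≡⟨ +-comm i 1 ⟩
    suc i                        ∎)
    where open ≡-Reasoning

  a-lrMax : LRMax v a
  a-lrMax = lrMax⁺ below-N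
    where
    below-N : ∀ {m} → 1 ≤ m → m < a → v m < v a
    below-N {m} 1≤m m<a = subst (v m <_) (sym v[v1]≡N)
      (≤∧≢⇒< (proj₂ (bounded 1≤m m≤N)) (<⇒≢ m<a ∘ maximum-at-a 1≤m m≤N))
      where
      m≤N : m ≤ N
      m≤N = ≤-trans (<⇒≤ m<a) (proj₂ a-bounds)

  expected⊆lrMaxPositions : ∀ {z} → z ∈ expected → z ∈ lrMaxPositions N v
  expected⊆lrMaxPositions (here refl) = ∈-lrMaxPositions⁺ N v ≤-refl 1≤N []
  expected⊆lrMaxPositions (there z∈) with ∈-++⁻ earlier z∈
  ... | inj₁ z∈earlier = ∈-lrMaxPositions⁺ N v (<⇒≤ after-first) (<⇒≤ before-last) (earlier-lrMax z∈earlier)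
    where open Kept (proj₁ (earlier-kept z∈earlier))
  ... | inj₂ (here refl) = uncurry (∈-lrMaxPositions⁺ N v) a-bounds a-lrMax

  lrMaxPositions⊆expected : ∀ {z} → z ∈ lrMaxPositions N v → z ∈ expected
  lrMaxPositions⊆expected {z} z∈ with ∈-lrMaxPositions⁻ N v z∈ | z ≟ 1 | z ≟ a
  ... | _ | yes refl | _ = here refl
  ... | _ | no _ | yes refl = there (∈-++⁺ʳ earlier (here refl))
  ... | (1≤z , z≤N) , lrz | no z≢1 | no z≢a =
    there (∈-++⁺ˡ (subst (_∈ earlier) pos≡z (∈-map⁺ pos (∈-take-sorted⁺ (lrMaxPositions-sorted n w) i j∈F j<x))))
    where
    1<z : 1 < z
    1<z = ≤∧≢⇒< 1≤z (z≢1 ∘ sym)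
    z<a : z < a
    z<a = ≤∧≢⇒< (≮⇒≥ λ a<z → <⇒≱ (subst (_< v z) v[v1]≡N (lrMax⁻ lrz (proj₁ a-bounds) a<z))
                                   (proj₂ (bounded 1≤z z≤N)))
                 z≢a
    kept : Kept N v z
    kept = kept-intro 1<z (<-≤-trans z<a (proj₂ a-bounds))
      (λ vz≡1 → <⇒≱ (lrMax⁻ lrz ≤-refl 1<z) (≤-trans (≤-reflexive vz≡1) (proj₁ a-bounds))) z≢a
    preimage : ∃[ j ] (1 ≤ j × j ≤ n) × pos j ≡ z
    preimage = pos-onto kept
    j : ℕ
    j = proj₁ preimage
    j-bounds : 1 ≤ j × j ≤ n
    j-bounds = proj₁ (proj₂ preimage)
    pos≡z : pos j ≡ z
    pos≡z = proj₂ (proj₂ preimage)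
    j∈F : j ∈ F
    j∈F = uncurry (∈-lrMaxPositions⁺ n w) j-bounds (uncurry lrMax-extend j-bounds λ kq q<pos →
            subst (λ t → v _ < v t) (sym pos≡z) (lrMax⁻ lrz (<⇒≤ (Kept.after-first kq)) (subst (_ <_) pos≡z q<pos)))
    j<x : j < x
    j<x = uncurry (uncurry pos-reflects-index j-bounds) x-bounds
            (subst₂ _<_ (sym pos≡z) (sym adjacent) (<-trans z<a (n<1+n a)))

  lrMax-count : length (lrMaxPositions N v) ≡ suc (suc i)
  lrMax-count = trans (cong length (AllPairs-≡ <-asym (lrMaxPositions-sorted N v) expected-sorted
                                      lrMaxPositions⊆expected expected⊆lrMaxPositions))
                      expected-length

lrMax-count-after-insertion : ∀ {n N w v i} → IsPerm N v → RotFixed N v → (occ : Occurrence n N w v) →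
  i < length (lrMaxPositions n w) → v (Occurrence.pos occ (nth (lrMaxPositions n w) i) ∸ 1) ≡ N →
  length (lrMaxPositions N v) ≡ suc (suc i)
lrMax-count-after-insertion {n} {N} {w} {v} {i} perm rot occ i<k left =
  InsertedMaximum.lrMax-count perm (rot 1 ≤-refl (<⇒≤ 1<N)) (rot 2 z<s 1<N)
    occ i i<k adjacent
  where
  open Occurrence occ
  x : ℕ
  x = nth (lrMaxPositions n w) i
  open Kept (uncurry pos-kept (proj₁ (∈-lrMaxPositions⁻ n w (nth-∈ _ i<k))))
  1<N : 1 < N
  1<N = <-trans after-first before-last
  adjacent : pos x ≡ suc (v 1)
  adjacent = trans (sym (suc[m∸1]≡m (<⇒≤ after-first)))
    (cong suc (RotationFixed.maximum-position perm rot (<⇒≤∸1 after-first)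
                 (≤-trans (m∸n≤m (pos x) 1) (<⇒≤ before-last)) left))

rlMax-count-after-insertion : ∀ {n N w v i} → IsPerm N v → RotFixed N v → (occ : Occurrence n N w v) →
  i < length (rlMaxPositions n w) → v (suc (Occurrence.pos occ (nth (rlMaxPositions n w) i))) ≡ N →
  length (rlMaxPositions N v) ≡ suc (suc i)
rlMax-count-after-insertion {n} {N} {w} {v} {i} perm rot occ i<k right = begin
  length (rlMaxPositions N v)            ≡⟨ cong length (rlMaxPositions-reflect N v) ⟩
  length (map (reflect N) reflectedLRs)  ≡⟨ length-map (reflect N) reflectedLRs ⟩
  length reflectedLRs                    ≡⟨ reflected-count ⟩
  suc (suc i)                            ∎
  where
  open ≡-Reasoning
  reflectedLRs : List ℕ
  reflectedLRs = lrMaxPositions N (λ p → v (reflect N p))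
  open Occurrence occ
  open RotationFixed perm rot
  F′ : List ℕ
  F′ = lrMaxPositions n (λ j → w (reflect n j))
  i<k′ : i < length F′
  i<k′ = subst (i <_) (trans (cong length (rlMaxPositions-reflect n w)) (length-map (reflect n) F′)) i<k
  y≡ : nth (rlMaxPositions n w) i ≡ reflect n (nth F′ i)
  y≡ = trans (cong (λ L → nth L i) (rlMaxPositions-reflect n w)) (nth-map (reflect n) F′ i<k′)
  o : ℕ
  o = pos (nth (rlMaxPositions n w) i)
  o-kept : Kept N v o
  o-kept = uncurry pos-kept (proj₁ (∈-rlMaxPositions↑⁻ n w (Any.reverse⁻ (nth-∈ _ i<k))))
  o<N : o < N
  o<N = Kept.before-last o-kept
  1<N : 1 < N
  1<N = <-trans (Kept.after-first o-kept) o<N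
  adjacent : reflect N (pos (reflect n (nth F′ i))) ≡ suc (v (reflect N 1))
  adjacent = begin
    reflect N (pos (reflect n (nth F′ i))) ≡⟨ cong (reflect N ∘ pos) (sym y≡) ⟩
    reflect N o                            ≡⟨ reflect-suc o<N ⟩
    suc (reflect N (suc o))                ≡⟨ cong (suc ∘ reflect N) (maximum-position z<s o<N right) ⟩
    suc (reflect N (v 1))                  ≡⟨ cong suc (sym (last-value (<⇒≤ 1<N))) ⟩
    suc (v N)                              ∎
  reflected-count : length reflectedLRs ≡ suc (suc i)
  reflected-count = InsertedMaximum.lrMax-count (Permutation.reflect-isPerm perm)
    (reflect-rotFixed 1 ≤-refl (<⇒≤ 1<N)) (reflect-rotFixed 2 z<s 1<N) (reflect-occurrence occ) i i<k′ adjacent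

lemma5p6 : (n : ℕ) (w : ℕ → ℕ) → IsPerm n w → IsBaxter n w → RotFixed n w →
    length (lrMaxPositions n w) ≡ length (rlMaxPositions n w) ×
    (∀ (i : ℕ) → 1 ≤ i → i ≤ length (lrMaxPositions n w) →
      ∀ (w' : ℕ → ℕ) → IsPerm (n + 4) w' → IsBaxter (n + 4) w' → RotFixed (n + 4) w' →
      DeletesTo n w' w →
      (w' (suc (origin n w' (nth (rlMaxPositions n w) (i ∸ 1)))) ≡ n + 4
        ⊎ w' (origin n w' (nth (lrMaxPositions n w) (i ∸ 1)) ∸ 1) ≡ n + 4) →
      (length (lrMaxPositions (n + 4) w') ≡ suc i ×
       length (rlMaxPositions (n + 4) w') ≡ suc i))
lemma5p6 n w perm _ rot = lr≡rl , λ where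
    (suc i) _ i<k w′ perm′ _ rot′ deletes (inj₁ right) →
      let rl : length (rlMaxPositions (n + 4) w′) ≡ suc (suc i)
          rl = rlMax-count-after-insertion perm′ rot′ (deletesTo-occurrence deletes) (subst (i <_) lr≡rl i<k) right
      in trans (RotationFixed.lrMax-count≡rlMax-count perm′ rot′) rl , rl
    (suc i) _ i<k w′ perm′ _ rot′ deletes (inj₂ left) →
      let lr : length (lrMaxPositions (n + 4) w′) ≡ suc (suc i)
          lr = lrMax-count-after-insertion perm′ rot′ (deletesTo-occurrence deletes) i<k left
      in lr , trans (sym (RotationFixed.lrMax-count≡rlMax-count perm′ rot′)) lr
  where
  lr≡rl : length (lrMaxPositions n w) ≡ length (rlMaxPositions n w)
  lr≡rl = RotationFixed.lrMax-count≡rlMax-count perm rot
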